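{- Let $(G_1,\ldots,G_T,\mathcal{D})$ be an instance of Monotonic Single-Source $k$-DTSN with $G_t=(V,E_t)$, edge weights $w$, and demands $\mathcal{D}=\{(a,b_i,t_i): i\in[k]\}$. Construct the Directed Steiner Tree instance $(G',D')$ as follows: $G'$ has a vertex $v^j$ for each $v\in V$ and $j\in[T]$; an edge $(u^j,v^j)$ of weight $w(u,v)$ for each $j\in[T]$ and each $(u,v)\in E_j$; and a zero-weight edge $(v^j,v^{j+1})$ for each $v\in V$ and $j\in[T-1]$. The demands are $D'=\{(a^1,b_i^{t_i}) : i\in[k]\}$. If the $k$-DTSN instance has a feasible solution of cost $C$, then $(G',D')$ has a feasible solution (a subgraph of $G'$ containing a directed path from $a^1$ to $b_i^{t_i}$ for every $i$) of cost at most $C$.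
   Context: Monotonic Single-Source $k$-DTSN: directed frames $G_1=(V,E_1),\ldots,G_T=(V,E_T)$ on a common vertex set with $E_t\subseteq E_{t'}$ whenever $t\le t'$, weights $w(e)\ge0$ on $E=\bigcup_tE_t$, and demands $(a,b_i,t_i)$, $i\in[k]$, with common root $a$. A feasible solution is a subgraph $\mathcal{H}$ of $(V,E)$ that, for each $i$, contains a directed $a\to b_i$ path all of whose edges lie in $E_{t_i}$; its cost is its total edge weight.
   Formalization: The edge weights w are rational. -}

module Defs where

open import Data.Nat using (ℕ; suc)
open import Data.Fin using (Fin; toℕ; _≤_) renaming (_≟_ to _≟ᶠ_)
open import Data.Bool using (Bool; true)
open import Data.Product using (_×_; _,_; ∃-syntax)
open import Data.List using (List; foldr)
open import Data.List.Relation.Unary.All using (All)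
open import Data.List.Relation.Unary.Unique.Propositional using (Unique)
open import Data.List.Membership.Propositional using (_∈_)
open import Data.Rational using (ℚ; 0ℚ; _+_)
open import Relation.Binary.PropositionalEquality using (_≡_)
open import Relation.Binary.Construct.Closure.ReflexiveTransitive using (Star)
open import Relation.Nullary using (yes; no)

-- Temporal graph on vertex set Fin n with T frames: E j u v ≡ true iff (u,v) ∈ E_j.
Frames : ℕ → ℕ → Set
Frames n T = Fin T → Fin n → Fin n → Bool

Monotone : ∀ {n T} → Frames n T → Set
Monotone {n} {T} E = ∀ {s t : Fin T} (u v : Fin n) → s ≤ t → E s u v ≡ true → E t u v ≡ true

InUnion : ∀ {n T} → Frames n T → Fin n × Fin n → Set
InUnion {T = T} E (u , v) = ∃[ j ] (E j u v ≡ true)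

cost : ∀ {A : Set} → (A → A → ℚ) → List (A × A) → ℚ
cost w = foldr (λ { (u , v) acc → w u v + acc }) 0ℚ

-- Feasible solution of the single-source k-DTSN instance with root a, demands (a, b i, t i):
-- a subgraph H of (V,E) (a set of edges, given as a duplicate-free list) containing, for every i,
-- a directed a → b i path all of whose edges lie in E_{t i}.
DTSN-Feasible : ∀ {n T k} → Frames n T → Fin n → (Fin k → Fin n) → (Fin k → Fin T)
              → List (Fin n × Fin n) → Set
DTSN-Feasible {k = k} E a b t H =
  Unique H × All (InUnion E) H ×
  (∀ (i : Fin k) → Star (λ x y → ((x , y) ∈ H) × (E (t i) x y ≡ true)) a (b i))

-- The layered graph G': vertex v^j is (v , j).
data Edge′ {n T} (E : Frames n T) : Fin n × Fin T → Fin n × Fin T → Set where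
  layer : ∀ {j u v} → E j u v ≡ true → Edge′ E (u , j) (v , j)
  step  : ∀ {j j′ v} → toℕ j′ ≡ suc (toℕ j) → Edge′ E (v , j) (v , j′)

-- Weight of G' edges: w(u,v) on layer edges (u^j,v^j), zero on edges between consecutive layers.
-- (Value on non-edges of G' is irrelevant.)
weight′ : ∀ {n T} → (Fin n → Fin n → ℚ) → Fin n × Fin T → Fin n × Fin T → ℚ
weight′ w (u , j) (v , j′) with j ≟ᶠ j′
... | yes _ = w u v
... | no  _ = 0ℚ

DST-Feasible : ∀ {n T k} → Frames n (suc T) → Fin n → (Fin k → Fin n) → (Fin k → Fin (suc T))
             → List ((Fin n × Fin (suc T)) × (Fin n × Fin (suc T))) → Set
DST-Feasible {k = k} E a b t H′ =
  Unique H′ × All (λ { (x , y) → Edge′ E x y }) H′ ×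
  (∀ (i : Fin k) → Star (λ x y → (x , y) ∈ H′) (a , Fin.zero) (b i , t i))
  where import Data.Fin as Fin

-- Put each edge e of H into a single layer ℓ(e): the earliest deadline t_i among the demands
-- whose path uses e (the last layer if no path uses it), and add every zero-weight edge
-- v^j → v^{j+1}. Each edge of H is then paid for exactly once. Monotonicity puts e into E_{ℓ(e)}.
-- To reach b_i^{t_i}, follow the path of demand i in layer t_i. An edge e on it with
-- ℓ(e) < t_i belongs to the path of a demand i′ with t_{i′} = ℓ(e) < t_i, so by induction on the
-- deadline its tail is reachable in layer ℓ(e); cross e there and ascend back to layer t_i.
module Submission where

open import Defs
open import Data.Nat using (ℕ; suc)
import Data.Nat as ℕ
import Data.Nat.Properties as ℕ
open import Data.Fin using (Fin; zero; suc; inject₁; fromℕ)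
import Data.Fin as F
import Data.Fin.Properties as F
open import Data.Fin.Induction using (<-weakInduction-startingFrom; <-wellFounded)
open import Data.Product using (_×_; _,_; proj₁; proj₂; Σ-syntax; ∃-syntax; uncurry)
open import Data.Product.Properties using (≡-dec)
open import Data.Sum using (_⊎_; inj₁; inj₂)
open import Data.Empty using (⊥-elim)
open import Data.List using (List; []; _∷_; _++_; map; filter; allFin; cartesianProduct)
open import Data.List.Relation.Unary.Any using (here; there)
open import Data.List.Relation.Unary.All using (All; []; _∷_; lookup; universal)
import Data.List.Relation.Unary.All as All
import Data.List.Relation.Unary.All.Properties as All
open import Data.List.Relation.Unary.Unique.Propositional using (Unique)
import Data.List.Relation.Unary.Unique.Propositional.Properties as Unique
open import Data.List.Membership.Propositional using (_∈_)
open import Data.List.Membership.Propositional.Properties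
  using (∈-allFin; ∈-map⁺; ∈-map⁻; ∈-filter⁺; ∈-filter⁻; ∈-++⁺ˡ; ∈-++⁺ʳ; ∈-cartesianProduct⁺)
import Data.List.Membership.DecPropositional as DecMembership
import Data.List.Extrema as Extrema
open import Data.Rational using (ℚ; 0ℚ; _+_; _≤_)
import Data.Rational.Properties as ℚ
open import Data.Bool using (true)
open import Function using (id; _∘_)
import Induction.WellFounded as WF
open import Relation.Binary.Construct.On using (wellFounded)
open import Relation.Binary.Definitions using (DecidableEquality)
open import Relation.Binary.PropositionalEquality
  using (_≡_; _≢_; refl; sym; trans; cong; cong₂; subst; module ≡-Reasoning)
open import Relation.Nullary using (Dec; yes; no; ¬_)
open import Relation.Binary.Construct.Closure.ReflexiveTransitive using (Star; ε; _◅_; _◅◅_; gmap)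

module _ {A : Set} where

  cost-++ : (w : A → A → ℚ) (xs ys : List (A × A)) → cost w (xs ++ ys) ≡ cost w xs + cost w ys
  cost-++ w []             ys = sym (ℚ.+-identityˡ _)
  cost-++ w ((u , v) ∷ xs) ys =
    trans (cong (w u v +_) (cost-++ w xs ys)) (sym (ℚ.+-assoc (w u v) _ _))

  cost-zero : (w : A → A → ℚ) {xs : List (A × A)} → All (λ e → uncurry w e ≡ 0ℚ) xs → cost w xs ≡ 0ℚ
  cost-zero w []       = refl
  cost-zero w (z ∷ zs) = trans (cong₂ _+_ z (cost-zero w zs)) (ℚ.+-identityˡ 0ℚ)

  cost-map : {B : Set} (w : A → A → ℚ) (w′ : B → B → ℚ) (f : A × A → B × B)
           → (∀ e → uncurry w′ (f e) ≡ uncurry w e) → ∀ xs → cost w′ (map f xs) ≡ cost w xs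
  cost-map w w′ f same []       = refl
  cost-map w w′ f same (e ∷ xs) = cong₂ _+_ (same e) (cost-map w w′ f same xs)

weight′-horizontal : ∀ {n T} (w : Fin n → Fin n → ℚ) (u v : Fin n) (j : Fin T)
                   → weight′ w (u , j) (v , j) ≡ w u v
weight′-horizontal w u v j with j F.≟ j
... | yes _ = refl
... | no j≢j = ⊥-elim (j≢j refl)

weight′-vertical : ∀ {n T} (w : Fin n → Fin n → ℚ) (u v : Fin n) {i j : Fin T}
                 → i ≢ j → weight′ w (u , i) (v , j) ≡ 0ℚ
weight′-vertical w u v {i} {j} i≢j with i F.≟ j
... | yes i≡j = ⊥-elim (i≢j i≡j)
... | no _    = refl

inject₁≢suc : ∀ {T} (j : Fin T) → inject₁ j ≢ suc j
inject₁≢suc j = F.<⇒≢ (ℕ.s≤s (ℕ.≤-reflexive (F.toℕ-inject₁ j)))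

≤⇒Star : ∀ {T} {R : Fin (suc T) → Fin (suc T) → Set}
       → (∀ j → R (inject₁ j) (suc j)) → ∀ {i j} → i F.≤ j → Star R i j
≤⇒Star {R = R} up {i} = <-weakInduction-startingFrom (Star R i) ε (λ j r → r ◅◅ (up j ◅ ε))

module _ {A : Set} {R : A → A → Set} where

  edges : ∀ {x y} → Star R x y → List (A × A)
  edges ε                 = []
  edges (_◅_ {x} {y} _ q) = (x , y) ∷ edges q

  edges-related : ∀ {x y} (q : Star R x y) {e} → e ∈ edges q → uncurry R e
  edges-related (r ◅ q) (here refl) = r
  edges-related (r ◅ q) (there e∈)  = edges-related q e∈

  propagate : ∀ {P : A → Set} {x y} (q : Star R x y) → P x
            → (∀ {e} → e ∈ edges q → P (proj₁ e) → P (proj₂ e))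
            → All (P ∘ proj₁) (edges q) × P y
  propagate ε       px advance = [] , px
  propagate (r ◅ q) px advance with propagate q (advance (here refl) px) (λ e∈ → advance (there e∈))
  ... | tails , py = px ∷ tails , py

module EarliestUse {A : Set} (_≟_ : DecidableEquality A) {k T : ℕ}
                   (uses : Fin k → List A) (t : Fin k → Fin (suc T)) where

  open DecMembership _≟_ using (_∈?_)
  open Extrema (F.≤-totalOrder (suc T)) using (min; min≤xs; argmin-sel)

  used? : ∀ e i → Dec (e ∈ uses i)
  used? e i = e ∈? uses i

  users : A → List (Fin k)
  users e = filter (used? e) (allFin k)

  earliest : A → Fin (suc T)
  earliest e = min (fromℕ T) (map t (users e))

  earliest-≤ : ∀ {e i} → e ∈ uses i → earliest e F.≤ t i
  earliest-≤ {e} {i} e∈ =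
    lookup (min≤xs (fromℕ T) (map t (users e))) (∈-map⁺ t (∈-filter⁺ (used? e) {xs = allFin k} (∈-allFin i) e∈))

  earliest-sel : ∀ e → earliest e ≡ fromℕ T ⊎ ∃[ i ] (e ∈ uses i × earliest e ≡ t i)
  earliest-sel e with argmin-sel id (fromℕ T) (map t (users e))
  ... | inj₁ eq = inj₁ eq
  ... | inj₂ m with ∈-map⁻ t m
  ...   | i , i∈ , eq = inj₂ (i , proj₂ (∈-filter⁻ (used? e) {xs = allFin k} i∈) , eq)

  earliest-attained : ∀ {e i} → e ∈ uses i → ∃[ i′ ] (e ∈ uses i′ × earliest e ≡ t i′)
  earliest-attained {e} {i} e∈ with earliest-sel e
  ... | inj₂ found = found
  ... | inj₁ eq    = i , e∈ , F.≤-antisym (earliest-≤ e∈) (subst (t i F.≤_) (sym eq) (F.≤fromℕ (t i)))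

module LayeredSolution {n T k : ℕ} (E : Frames n (suc T)) (a : Fin n)
                       (b : Fin k → Fin n) (t : Fin k → Fin (suc T)) (H : List (Fin n × Fin n))
                       (paths : ∀ i → Star (λ x y → ((x , y) ∈ H) × (E (t i) x y ≡ true)) a (b i))
                       where

  open EarliestUse (≡-dec F._≟_ F._≟_) (λ i → edges (paths i)) t

  Vertex′ : Set
  Vertex′ = Fin n × Fin (suc T)

  place : Fin n × Fin n → Vertex′ × Vertex′
  place (u , v) = (u , earliest (u , v)) , (v , earliest (u , v))

  ascend : Fin n × Fin T → Vertex′ × Vertex′
  ascend (v , j) = (v , inject₁ j) , (v , suc j)

  ascents : List (Vertex′ × Vertex′)
  ascents = map ascend (cartesianProduct (allFin n) (allFin T))

  H′ : List (Vertex′ × Vertex′)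
  H′ = map place H ++ ascents

  place-injective : ∀ {e e′} → place e ≡ place e′ → e ≡ e′
  place-injective {u , v} eq = cong₂ _,_ (cong (proj₁ ∘ proj₁) eq) (cong (proj₁ ∘ proj₂) eq)

  ascend-injective : ∀ {p p′} → ascend p ≡ ascend p′ → p ≡ p′
  ascend-injective {v , j} eq =
    cong₂ _,_ (cong (proj₁ ∘ proj₁) eq) (F.suc-injective (cong (proj₂ ∘ proj₂) eq))

  Horizontal : Vertex′ × Vertex′ → Set
  Horizontal ((_ , i) , (_ , j)) = i ≡ j

  placed-horizontal : ∀ {p} → p ∈ map place H → Horizontal p
  placed-horizontal p∈ with ∈-map⁻ place p∈
  ... | _ , _ , refl = refl

  ascents-vertical : ∀ {p} → p ∈ ascents → ¬ Horizontal p
  ascents-vertical p∈ with ∈-map⁻ ascend p∈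
  ... | (_ , j) , _ , refl = inject₁≢suc j

  unique-H′ : Unique H → Unique H′
  unique-H′ unique = Unique.++⁺ (Unique.map⁺ place-injective unique)
    (Unique.map⁺ ascend-injective (Unique.cartesianProduct⁺ (Unique.allFin⁺ n) (Unique.allFin⁺ T)))
    (λ (p∈ , p∈′) → ascents-vertical p∈′ (placed-horizontal p∈))

  cost-H′ : (w : Fin n → Fin n → ℚ) → cost (weight′ w) H′ ≡ cost w H
  cost-H′ w = begin
    cost (weight′ w) (map place H ++ ascents)
      ≡⟨ cost-++ (weight′ w) (map place H) ascents ⟩
    cost (weight′ w) (map place H) + cost (weight′ w) ascents
      ≡⟨ cong₂ _+_ (cost-map w (weight′ w) place placed-weight H)
                   (cost-zero (weight′ w) (All.map⁺ (universal ascent-weightless (cartesianProduct (allFin n) (allFin T))))) ⟩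
    cost w H + 0ℚ
      ≡⟨ ℚ.+-identityʳ _ ⟩
    cost w H ∎
    where
    open ≡-Reasoning
    placed-weight : ∀ e → uncurry (weight′ w) (place e) ≡ uncurry w e
    placed-weight (u , v) = weight′-horizontal w u v (earliest (u , v))
    ascent-weightless : ∀ p → uncurry (weight′ w) (ascend p) ≡ 0ℚ
    ascent-weightless (v , j) = weight′-vertical w v v (inject₁≢suc j)

  earliest-present : Monotone E → ∀ e → InUnion E e → E (earliest e) (proj₁ e) (proj₂ e) ≡ true
  earliest-present mono (u , v) (j , present) with earliest-sel (u , v)
  ... | inj₁ eq =
    subst (λ s → E s u v ≡ true) (sym eq) (mono u v (F.≤fromℕ j) present)
  ... | inj₂ (i , e∈ , eq) =
    subst (λ s → E s u v ≡ true) (sym eq) (proj₂ (edges-related (paths i) e∈))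

  H′-edges : Monotone E → All (InUnion E) H → All (uncurry (Edge′ E)) H′
  H′-edges mono inUnion = All.++⁺
    (All.map⁺ (All.map (λ {e} present → layer (earliest-present mono e present)) inUnion))
    (All.map⁺ (universal (λ (_ , j) → step (cong suc (sym (F.toℕ-inject₁ j)))) _))

  Reach : Fin (suc T) → Fin n → Set
  Reach s x = Star (λ p q → (p , q) ∈ H′) (a , zero) (x , s)

  climb : ∀ {s s′ x} → s F.≤ s′ → Reach s x → Reach s′ x
  climb {x = x} s≤s′ r = r ◅◅ gmap (x ,_) id (≤⇒Star ascent∈H′ s≤s′)
    where
    ascent∈H′ : ∀ j → ((x , inject₁ j) , (x , suc j)) ∈ H′
    ascent∈H′ j = ∈-++⁺ʳ (map place H) (∈-map⁺ ascend (∈-cartesianProduct⁺ (∈-allFin x) (∈-allFin j)))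

  cross : ∀ {e} → e ∈ H → Reach (earliest e) (proj₁ e) → Reach (earliest e) (proj₂ e)
  cross e∈ r = r ◅◅ (∈-++⁺ˡ (∈-map⁺ place e∈) ◅ ε)

  DemandReached : Fin k → Set
  DemandReached i = All (Reach (t i) ∘ proj₁) (edges (paths i)) × Reach (t i) (b i)

  demand-reached : ∀ i → DemandReached i
  demand-reached = WF.All.wfRec (wellFounded t <-wellFounded) _ DemandReached reached
    where
    reached : ∀ i → (∀ {i′} → t i′ F.< t i → DemandReached i′) → DemandReached i
    reached i earlier = propagate (paths i) (climb ℕ.z≤n ε) advance
      where
      advance : ∀ {e} → e ∈ edges (paths i) → Reach (t i) (proj₁ e) → Reach (t i) (proj₂ e)
      advance {e} e∈ r = climb (earliest-≤ e∈) (cross (proj₁ (edges-related (paths i) e∈)) tail-reached)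
        where
        tail-reached : Reach (earliest e) (proj₁ e)
        tail-reached with earliest e F.≟ t i
        ... | yes eq = subst (λ s → Reach s (proj₁ e)) (sym eq) r
        ... | no ne with earliest-attained e∈
        ...   | i′ , e∈′ , eq =
          subst (λ s → Reach s (proj₁ e)) (sym eq)
            (lookup (proj₁ (earlier (subst (F._< t i) eq (F.≤∧≢⇒< (earliest-≤ e∈) ne)))) e∈′)

lemma14 : (n T k : ℕ) (E : Frames n (suc T)) → Monotone E
    → (w : Fin n → Fin n → ℚ)
    → (∀ (j : Fin (suc T)) (u v : Fin n) → E j u v ≡ true → 0ℚ ≤ w u v)
    → (a : Fin n) (b : Fin k → Fin n) (t : Fin k → Fin (suc T))
    → (H : List (Fin n × Fin n)) → DTSN-Feasible E a b t H
    → Σ[ H′ ∈ List ((Fin n × Fin (suc T)) × (Fin n × Fin (suc T))) ]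
    (DST-Feasible E a b t H′ × (cost (weight′ w) H′ ≤ cost w H))
lemma14 n T k E mono w _ a b t H (unique , inUnion , paths) =
  H′ , (unique-H′ unique , H′-edges mono inUnion , proj₂ ∘ demand-reached) , ℚ.≤-reflexive (cost-H′ w)
  where open LayeredSolution E a b t H paths
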